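{- Let $G=(V,E)$ be a graph, let $S\subseteq V$ be a minimal separator of $G$ that is a clique, and let $A$ be a full component for $S$. Then $tb(G)=1$ if and only if both $tb(G[A\cup S])=1$ and $tb(G[V\setminus A])=1$.
   Context: Graphs are finite, simple, connected and unweighted. A separator of $G$ is a set $S\subseteq V$ such that $G\setminus S$ has at least two connected components; a full component for $S$ is a connected component $C$ of $G\setminus S$ with $N(C)=S$; a minimal separator is a separator with at least two full components. A tree decomposition of a graph $H$ is a tree $T$ with bags $X_t\subseteq V(H)$ such that every vertex lies in a bag, every edge has both ends in a common bag, and for each vertex the bags containing it induce a subtree; its breadth is $\max_t\min_{v\in V(H)}\max_{w\in X_t}dist_H(v,w)$, and $tb(H)$ is the minimum breadth of a tree decomposition of $H$. -}

module Defs where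

open import Data.Nat using (ℕ; zero; suc; _≤_)
open import Data.Fin using (Fin; zero; suc; toℕ)
open import Data.Fin.Subset using (Subset; _∈_; _∉_; _⊆_; ⊤; ∁; _∪_) public
open import Data.Vec using (tabulate; lookup)
open import Data.Bool using (Bool; true; false)
open import Data.Product using (Σ; ∃; ∃-syntax; _×_; _,_)
open import Data.Sum using (_⊎_)
open import Relation.Binary.PropositionalEquality using (_≡_; _≢_)
open import Relation.Nullary using (¬_)

record Graph (n : ℕ) : Set where
  field
    adj    : Fin n → Fin n → Bool
    sym    : ∀ u v → adj u v ≡ adj v u
    irrefl : ∀ u → adj u u ≡ false
open Graph public

Edge : ∀ {n} → Graph n → Fin n → Fin n → Set
Edge G u v = adj G u v ≡ true

data Walk {n : ℕ} (R : Fin n → Fin n → Set) (U : Subset n) : Fin n → Fin n → ℕ → Set where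
  here : ∀ {u} → u ∈ U → Walk R U u u zero
  step : ∀ {u w v k} → u ∈ U → R u w → Walk R U w v k → Walk R U u v (suc k)

ConnectedOn : ∀ {n} → (Fin n → Fin n → Set) → Subset n → Set
ConnectedOn R X = ∀ u v → u ∈ X → v ∈ X → ∃[ k ] Walk R X u v k

Connected : ∀ {n} → Graph n → Set
Connected G = ConnectedOn (Edge G) ⊤

DistLe : ∀ {n} → Graph n → Subset n → Fin n → Fin n → ℕ → Set
DistLe G U u v k = ∃[ l ] (l ≤ k × Walk (Edge G) U u v l)

Component : ∀ {n} → Graph n → Subset n → Subset n → Set
Component {n} G S C =
  (∀ v → v ∈ C → v ∉ S)
  × (∃[ v ] v ∈ C)
  × ConnectedOn (Edge G) C
  × (∀ u w → u ∈ C → w ∉ S → Edge G u w → w ∈ C)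

InNbhd : ∀ {n} → Graph n → Subset n → Fin n → Set
InNbhd G C v = v ∉ C × ∃[ c ] (c ∈ C × Edge G c v)

FullComponent : ∀ {n} → Graph n → Subset n → Subset n → Set
FullComponent G S C =
  Component G S C × (∀ v → (InNbhd G C v → v ∈ S) × (v ∈ S → InNbhd G C v))

MinimalSeparator : ∀ {n} → Graph n → Subset n → Set
MinimalSeparator G S =
  ∃[ C₁ ] ∃[ C₂ ] (FullComponent G S C₁ × FullComponent G S C₂ × C₁ ≢ C₂)

Clique : ∀ {n} → Graph n → Subset n → Set
Clique G S = ∀ u v → u ∈ S → v ∈ S → u ≢ v → Edge G u v

-- A finite tree on nodes Fin (suc m), given by a parent function:
-- node (suc i) is joined to node (parent i), whose index is ≤ i.
-- (Every finite tree is isomorphic to one of this form.)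
record Tree : Set where
  field
    m       : ℕ
    parent  : Fin m → Fin (suc m)
    parent< : ∀ i → toℕ (parent i) ≤ toℕ i
open Tree public

TreeAdj : (T : Tree) → Fin (suc (m T)) → Fin (suc (m T)) → Set
TreeAdj T s t =
  (∃[ i ] (s ≡ suc i × parent T i ≡ t)) ⊎ (∃[ i ] (t ≡ suc i × parent T i ≡ s))

nodesWith : ∀ {n} (T : Tree) → (Fin (suc (m T)) → Subset n) → Fin n → Subset (suc (m T))
nodesWith T X v = tabulate (λ t → lookup (X t) v)

record TreeDecomposition {n : ℕ} (G : Graph n) (U : Subset n) : Set where
  field
    tree      : Tree
    bag       : Fin (suc (m tree)) → Subset n
    bag⊆      : ∀ t → bag t ⊆ U
    covers    : ∀ v → v ∈ U → ∃[ t ] v ∈ bag t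
    edges     : ∀ u v → u ∈ U → v ∈ U → Edge G u v → ∃[ t ] (u ∈ bag t × v ∈ bag t)
    subtree   : ∀ v → v ∈ U → ConnectedOn (TreeAdj tree) (nodesWith tree bag v)
open TreeDecomposition public

-- breadth(D) ≤ k, i.e. max_t min_{v ∈ U} max_{w ∈ X_t} dist_{G[U]}(v,w) ≤ k
BreadthLe : ∀ {n} {G : Graph n} {U : Subset n} → TreeDecomposition G U → ℕ → Set
BreadthLe {G = G} {U} D k =
  ∀ t → ∃[ v ] (v ∈ U × (∀ w → w ∈ bag D t → DistLe G U v w k))

-- tb(G[U]) = 1 : some tree decomposition has breadth ≤ 1 and none has breadth ≤ 0
-- (breadths are natural numbers, so this says exactly that the minimum is 1)
TbOne : ∀ {n} → Graph n → Subset n → Set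
TbOne G U =
  (∃[ D ] BreadthLe {G = G} {U} D 1) × (∀ (D : TreeDecomposition G U) → ¬ BreadthLe D 0)

-- (⇒) Restricting a breadth-1 decomposition of G to A ∪ S or to V ∖ A keeps breadth 1:
-- a bag whose centre falls outside the part meets it only inside the clique S.
-- (⇐) By the Helly property of subtrees, each part has a bag containing the clique S.
-- Rerooting the decomposition of V ∖ A at that bag and hanging it below the bag of A ∪ S
-- gives a decomposition of G, because the two parts cover G, meet exactly in S and
-- together contain every edge. Breadth 0 is excluded on every side by an edge at a
-- vertex of S (towards A, and towards a second full component).

module Submission where

open import Defs
open import Level using (0ℓ)
open import Data.Nat as ℕ using (ℕ; zero; suc; _≤_; _<_; z≤n; s≤s; _+_)
open import Data.Nat.Properties as ℕ using (≤-trans; ≤-refl; ≤-reflexive)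
open import Data.Fin as Fin using (Fin; zero; suc; toℕ; inject₁; fromℕ; lower₁; _↑ˡ_; _↑ʳ_; splitAt)
open import Data.Fin.Properties
  using (toℕ-injective; toℕ-inject₁; toℕ-fromℕ; toℕ-lower₁; inject₁-lower₁; toℕ<n; toℕ-↑ˡ; toℕ-↑ʳ; splitAt-↑ˡ; splitAt-↑ʳ)
open import Data.Fin.Relation.Unary.Top using (view; ‵fromℕ; ‵inj₁)
open import Data.Fin.Subset using (_∩_; Nonempty)
open import Data.Fin.Subset.Properties
  using (∈⊤; _∈?_; nonempty?; x∈p∪q⁺; x∈p∪q⁻; x∈p∩q⁺; x∈p∩q⁻; x∈∁p⇒x∉p; x∉p⇒x∈∁p; x∉∁p⇒x∈p; ⊆-antisym)
open import Data.Vec using (lookup)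
open import Data.Vec.Properties using (lookup∘tabulate; []=⇒lookup; lookup⇒[]=; ≡-dec)
open import Data.Bool.Properties using () renaming (_≟_ to _≟ᵇ_)
open import Data.Product
open import Data.Sum
open import Data.Empty
open import Function using (_∘_)
open import Function.Bundles using (_⇔_; mk⇔)
open import Relation.Nullary
open import Relation.Unary using (Pred; Decidable)
open import Relation.Binary.PropositionalEquality
  using (_≡_; _≢_; refl; cong; trans; subst; subst₂; module ≡-Reasoning) renaming (sym to ≡-sym)

module _ {n} {R : Fin n → Fin n → Set} where

  walk-source∈ : ∀ {U u v k} → Walk R U u v k → u ∈ U
  walk-source∈ (here u∈U)     = u∈U
  walk-source∈ (step u∈U _ _) = u∈U

  _++ʷ_ : ∀ {U u v w k l} → Walk R U u v k → Walk R U v w l → Walk R U u w (k + l)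
  here _       ++ʷ q = q
  step u∈U r p ++ʷ q = step u∈U r (p ++ʷ q)

walk-map : ∀ {n n′} {R : Fin n → Fin n → Set} {R′ : Fin n′ → Fin n′ → Set} {U U′}
           (h : Fin n → Fin n′) → (∀ {x y} → R x y → R′ (h x) (h y)) → (∀ {x} → x ∈ U → h x ∈ U′)
         → ∀ {u v k} → Walk R U u v k → Walk R′ U′ (h u) (h v) k
walk-map h hR hU (here u∈U)     = here (hU u∈U)
walk-map h hR hU (step u∈U r p) = step (hU u∈U) (hR r) (walk-map h hR hU p)

walk-mono : ∀ {n} {R : Fin n → Fin n → Set} {U U′} → U ⊆ U′ → ∀ {u v k} → Walk R U u v k → Walk R U′ u v k
walk-mono U⊆U′ = walk-map (λ x → x) (λ r → r) U⊆U′

Node : Tree → Set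
Node T = Fin (suc (m T))

module _ {n} (T : Tree) (X : Node T → Subset n) {v : Fin n} {t : Node T} where

  ∈nodesWith⁺ : v ∈ X t → t ∈ nodesWith T X v
  ∈nodesWith⁺ v∈X = lookup⇒[]= t _ (trans (lookup∘tabulate (λ s → lookup (X s) v) t) ([]=⇒lookup v∈X))

  ∈nodesWith⁻ : t ∈ nodesWith T X v → v ∈ X t
  ∈nodesWith⁻ t∈N = lookup⇒[]= v _ (trans (≡-sym (lookup∘tabulate (λ s → lookup (X s) v) t)) ([]=⇒lookup t∈N))

data Descendant (T : Tree) (a : Node T) : Node T → Set where
  self  : Descendant T a a
  child : ∀ {i} → Descendant T a (parent T i) → Descendant T a (suc i)

module _ {T : Tree} where

  descendant⇒≤ : ∀ {a x} → Descendant T a x → toℕ a ≤ toℕ x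
  descendant⇒≤ self                = ≤-refl
  descendant⇒≤ (child {i} a≼pi) = ≤-trans (descendant⇒≤ a≼pi) (≤-trans (parent< T i) (ℕ.n≤1+n _))

  descendant? : ∀ a x → Dec (Descendant T a x)
  descendant? a x = bounded (toℕ x) x ≤-refl
    where
    bounded : ∀ f x → toℕ x ≤ f → Dec (Descendant T a x)
    bounded _ x _ with a Fin.≟ x
    ... | yes refl = yes self
    bounded f zero _ | no a≢0 = no λ { self → a≢0 refl }
    bounded (suc f) (suc i) (s≤s i≤f) | no a≢x with bounded f (parent T i) (≤-trans (parent< T i) i≤f)
    ... | yes a≼pi = yes (child a≼pi)
    ... | no a⋠pi  = no λ { self → a≢x refl ; (child a≼pi) → a⋠pi a≼pi }

  -- The only tree edge between the descendants of suc i and the rest is the one to parent i.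
  walk-leaving-descendants : ∀ {X i x r k} → Walk (TreeAdj T) X x r k
    → Descendant T (suc i) x → ¬ Descendant T (suc i) r → parent T i ∈ X
  walk-leaving-descendants (here _) d ¬d = ⊥-elim (¬d d)
  walk-leaving-descendants {i = i} (step {w = w} _ x~w p) d ¬d with descendant? (suc i) w
  ... | yes d′ = walk-leaving-descendants p d′ ¬d
  ... | no ¬d′ with x~w | d
  ...   | inj₁ (_ , refl , refl) | self     = walk-source∈ p
  ...   | inj₁ (_ , refl , refl) | child d″ = ⊥-elim (¬d′ d″)
  ...   | inj₂ (_ , refl , refl) | _        = ⊥-elim (¬d′ (child d))

  connected⇒parent∈ : ∀ {X} → ConnectedOn (TreeAdj T) X → ∀ {i r} → suc i ∈ X → r ∈ X
    → toℕ r < toℕ (suc {m T} i) → parent T i ∈ X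
  connected⇒parent∈ conn si∈X r∈X r<si =
    walk-leaving-descendants (proj₂ (conn _ _ si∈X r∈X)) self (ℕ.<⇒≱ r<si ∘ descendant⇒≤)

  connected⇒descendant-of-least : ∀ {X} → ConnectedOn (TreeAdj T) X → ∀ {r} → r ∈ X
    → (∀ y → y ∈ X → toℕ r ≤ toℕ y) → ∀ {t} → t ∈ X → Descendant T r t
  connected⇒descendant-of-least {X} conn {r} r∈X r-least {t} = bounded (toℕ t) t ≤-refl
    where
    bounded : ∀ f t → toℕ t ≤ f → t ∈ X → Descendant T r t
    bounded _ t _ _ with r Fin.≟ t
    ... | yes refl = self
    bounded f zero _ 0∈X | no r≢0 = ⊥-elim (r≢0 (toℕ-injective (ℕ.n≤0⇒n≡0 (r-least zero 0∈X))))
    bounded (suc f) (suc i) (s≤s i≤f) si∈X | no r≢si =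
      child (bounded f (parent T i) (≤-trans (parent< T i) i≤f) (connected⇒parent∈ conn si∈X r∈X r<si))
      where r<si = ℕ.≤∧≢⇒< (r-least (suc i) si∈X) (r≢si ∘ toℕ-injective)

  ancestors-comparable : ∀ {a b t} → Descendant T a t → Descendant T b t → toℕ a ≤ toℕ b → Descendant T a b
  ancestors-comparable a≼t        self             _   = a≼t
  ancestors-comparable self       (child {i} b≼pi) a≤b =
    ⊥-elim (ℕ.<⇒≱ (s≤s (≤-trans (descendant⇒≤ b≼pi) (parent< T i))) a≤b)
  ancestors-comparable (child a≼pi) (child b≼pi) a≤b = ancestors-comparable a≼pi b≼pi a≤b

  connected-convex : ∀ {X} → ConnectedOn (TreeAdj T) X → ∀ {r a t} → r ∈ X
    → Descendant T r a → Descendant T a t → t ∈ X → a ∈ X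
  connected-convex conn r∈X r≼a self             t∈X = t∈X
  connected-convex conn r∈X r≼a (child {i} a≼pi) t∈X =
    connected-convex conn r∈X r≼a a≼pi (connected⇒parent∈ conn t∈X r∈X
      (s≤s (≤-trans (descendant⇒≤ r≼a) (≤-trans (descendant⇒≤ a≼pi) (parent< T i)))))

least : ∀ {k} {P : Pred (Fin k) 0ℓ} → Decidable P → ∃ P → ∃ λ x → P x × ∀ y → P y → toℕ x ≤ toℕ y
least {suc k} P? (x , px) with P? zero
... | yes p0 = zero , p0 , λ _ _ → z≤n
... | no ¬p0 with x | px
...   | zero  | p0 = ⊥-elim (¬p0 p0)
...   | suc x | px with least (P? ∘ suc) (x , px)
...     | y , py , min = suc y , py , λ { zero p0 → ⊥-elim (¬p0 p0) ; (suc z) pz → s≤s (min z pz) }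

argmax : ∀ {k} {P : Pred (Fin k) 0ℓ} → Decidable P → (f : Fin k → ℕ)
       → (∃ λ x → P x × ∀ y → P y → f y ≤ f x) ⊎ (∀ y → ¬ P y)
argmax {zero} P? f = inj₂ λ ()
argmax {suc k} P? f with argmax (P? ∘ suc) (f ∘ suc) | P? zero
... | inj₂ none | yes p0 = inj₁ (zero , p0 , λ { zero _ → ≤-refl ; (suc y) py → ⊥-elim (none y py) })
... | inj₂ none | no ¬p0 = inj₂ λ { zero p0 → ¬p0 p0 ; (suc y) py → none y py }
... | inj₁ (x , px , max) | no ¬p0 = inj₁ (suc x , px , λ { zero p0 → ⊥-elim (¬p0 p0) ; (suc y) py → max y py })
... | inj₁ (x , px , max) | yes p0 with f zero ℕ.≤? f (suc x)
...   | yes f0≤ = inj₁ (suc x , px , λ { zero _ → f0≤ ; (suc y) py → max y py })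
...   | no  f0≰ = inj₁ (zero , p0 , λ { zero _ → ≤-refl ; (suc y) py → ≤-trans (max y py) (ℕ.≰⇒≥ f0≰) })

-- The Helly property for cliques

module _ {n} {G : Graph n} {U : Subset n} (D : TreeDecomposition G U) where
  private
    T = tree D
    nodes : Fin n → Subset (suc (m T))
    nodes v = nodesWith T (bag D) v

  -- The least node whose bag contains v (zero if there is none).
  top : Fin n → Node T
  top v with nonempty? (nodes v)
  ... | yes ne = proj₁ (least (_∈? nodes v) ne)
  ... | no _   = zero

  top-least : ∀ {v} → v ∈ U → top v ∈ nodes v × (∀ t → t ∈ nodes v → toℕ (top v) ≤ toℕ t)
  top-least {v} v∈U with nonempty? (nodes v)
  ... | yes ne    = proj₂ (least (_∈? nodes v) ne)
  ... | no  empty = ⊥-elim (empty (_ , ∈nodesWith⁺ T (bag D) (proj₂ (covers D v v∈U))))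

  descendant-of-top : ∀ {v t} → v ∈ U → v ∈ bag D t → Descendant T (top v) t
  descendant-of-top {v} v∈U v∈t =
    connected⇒descendant-of-least (subtree D v v∈U) (proj₁ (top-least v∈U)) (proj₂ (top-least v∈U))
      (∈nodesWith⁺ T (bag D) v∈t)

  -- The deepest top among the vertices of S lies, in the subtree of every other u ∈ S,
  -- between top u and a bag shared with it.
  clique⊆bag : ∀ {S} → Clique G S → S ⊆ U → ∃ λ t → S ⊆ bag D t
  clique⊆bag {S} clique S⊆U with argmax (_∈? S) (toℕ ∘ top)
  ... | inj₂ S-empty           = zero , λ {u} u∈S → ⊥-elim (S-empty u u∈S)
  ... | inj₁ (s , s∈S , deepest) = top s , λ {u} u∈S → u∈top-s u u∈S
    where
    u∈top-s : ∀ u → u ∈ S → u ∈ bag D (top s)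
    u∈top-s u u∈S with u Fin.≟ s
    ... | yes refl = ∈nodesWith⁻ T (bag D) (proj₁ (top-least (S⊆U u∈S)))
    ... | no u≢s with edges D u s (S⊆U u∈S) (S⊆U s∈S) (clique u s u∈S s∈S u≢s)
    ...   | t , u∈t , s∈t = ∈nodesWith⁻ T (bag D)
            (connected-convex (subtree D u (S⊆U u∈S)) (proj₁ (top-least (S⊆U u∈S)))
              (ancestors-comparable (descendant-of-top (S⊆U u∈S) u∈t) top-s≼t (deepest u u∈S))
              top-s≼t (∈nodesWith⁺ T (bag D) u∈t))
      where top-s≼t = descendant-of-top (S⊆U s∈S) s∈t

-- Rerooting

TreeAdj-sym : ∀ {T a b} → TreeAdj T a b → TreeAdj T b a
TreeAdj-sym (inj₁ e) = inj₂ e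
TreeAdj-sym (inj₂ e) = inj₁ e

record TreeIso (T T′ : Tree) : Set where
  field
    to      : Node T → Node T′
    from    : Node T′ → Node T
    to∘from : ∀ x → to (from x) ≡ x
    from∘to : ∀ x → from (to x) ≡ x
    to-edge : ∀ i → TreeAdj T′ (to (suc i)) (to (parent T i))

  to-adj : ∀ {a b} → TreeAdj T a b → TreeAdj T′ (to a) (to b)
  to-adj (inj₁ (i , refl , refl)) = to-edge i
  to-adj (inj₂ (i , refl , refl)) = TreeAdj-sym {T′} (to-edge i)
open TreeIso

TreeIso-refl : ∀ T → TreeIso T T
TreeIso-refl T = record
  { to = λ x → x ; from = λ x → x ; to∘from = λ _ → refl ; from∘to = λ _ → refl
  ; to-edge = λ i → inj₁ (i , refl , refl) }

_∘ᵗ_ : ∀ {T T′ T″} → TreeIso T′ T″ → TreeIso T T′ → TreeIso T T″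
J ∘ᵗ I = record
  { to      = to J ∘ to I
  ; from    = from I ∘ from J
  ; to∘from = λ x → trans (cong (to J) (to∘from I (from J x))) (to∘from J x)
  ; from∘to = λ x → trans (cong (from I) (from∘to J (to I x))) (from∘to I x)
  ; to-edge = λ i → to-adj J (to-edge I i) }

module _ {n} {G : Graph n} {U : Subset n} (D : TreeDecomposition G U) {T′} (I : TreeIso (tree D) T′) where
  private
    T    = tree D
    bag′ = bag D ∘ from I
    moved : ∀ {v} x → v ∈ bag D x → v ∈ bag′ (to I x)
    moved {v} x = subst (λ y → v ∈ bag D y) (≡-sym (from∘to I x))

  transfer : TreeDecomposition G U
  transfer = record
    { tree    = T′
    ; bag     = bag′
    ; bag⊆    = bag⊆ D ∘ from I
    ; covers  = λ v v∈U → let t , v∈t = covers D v v∈U in to I t , moved t v∈t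
    ; edges   = λ u v u∈U v∈U u~v → let t , u∈t , v∈t = edges D u v u∈U v∈U u~v in
                  to I t , moved t u∈t , moved t v∈t
    ; subtree = λ v v∈U a b a∋v b∋v →
        let k , p = subtree D v v∈U (from I a) (from I b)
                      (∈nodesWith⁺ T (bag D) (∈nodesWith⁻ T′ bag′ a∋v))
                      (∈nodesWith⁺ T (bag D) (∈nodesWith⁻ T′ bag′ b∋v))
        in k , subst₂ (λ x y → Walk (TreeAdj T′) (nodesWith T′ bag′ v) x y k) (to∘from I a) (to∘from I b)
                 (walk-map (to I) (to-adj I) (λ {x} x∋v → ∈nodesWith⁺ T′ bag′ (moved x (∈nodesWith⁻ T (bag D) x∋v))) p)
    }

  transfer-breadth : ∀ {k} → BreadthLe D k → BreadthLe transfer k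
  transfer-breadth b t = b (from I t)

caseLast : ∀ {k} {A : Set} → A → (Fin k → A) → Fin (suc k) → A
caseLast {zero}  a f zero    = a
caseLast {suc k} a f zero    = f zero
caseLast {suc k} a f (suc x) = caseLast a (f ∘ suc) x

caseLast-fromℕ : ∀ {k} {A : Set} (a : A) (f : Fin k → A) → caseLast a f (fromℕ k) ≡ a
caseLast-fromℕ {zero}  a f = refl
caseLast-fromℕ {suc k} a f = caseLast-fromℕ a (f ∘ suc)

caseLast-inject₁ : ∀ {k} {A : Set} (a : A) (f : Fin k → A) y → caseLast a f (inject₁ y) ≡ f y
caseLast-inject₁ {suc k} a f zero    = refl
caseLast-inject₁ {suc k} a f (suc y) = caseLast-inject₁ a (f ∘ suc) y

liftLast : ∀ {k l} → (Fin k → Fin l) → Fin (suc k) → Fin (suc l)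
liftLast f = caseLast (fromℕ _) (inject₁ ∘ f)

liftLast-inverse : ∀ {k l} (f : Fin k → Fin l) (g : Fin l → Fin k) → (∀ y → f (g y) ≡ y)
                 → ∀ y → liftLast f (liftLast g y) ≡ y
liftLast-inverse {k} {l} f g fg y with view y
... | ‵fromℕ = begin
  liftLast f (liftLast g (fromℕ l)) ≡⟨ cong (liftLast f) (caseLast-fromℕ (fromℕ k) (inject₁ ∘ g)) ⟩
  liftLast f (fromℕ k)              ≡⟨ caseLast-fromℕ (fromℕ l) (inject₁ ∘ f) ⟩
  fromℕ l                           ∎
  where open ≡-Reasoning
... | ‵inj₁ {i = y} _ = begin
  liftLast f (liftLast g (inject₁ y)) ≡⟨ cong (liftLast f) (caseLast-inject₁ (fromℕ k) (inject₁ ∘ g) y) ⟩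
  liftLast f (inject₁ (g y))          ≡⟨ caseLast-inject₁ (fromℕ l) (inject₁ ∘ f) (g y) ⟩
  inject₁ (f (g y))                   ≡⟨ cong inject₁ (fg y) ⟩
  inject₁ y                           ∎
  where open ≡-Reasoning

snocParent : (T : Tree) → Node T → Fin (suc (m T)) → Fin (suc (suc (m T)))
snocParent T q = caseLast (inject₁ q) (inject₁ ∘ parent T)

snoc : (T : Tree) → Node T → Tree
snoc T q = record { m = suc (m T) ; parent = snocParent T q ; parent< = snoc-parent< }
  where
  snoc-parent< : ∀ i → toℕ (snocParent T q i) ≤ toℕ i
  snoc-parent< i with view i
  ... | ‵fromℕ rewrite caseLast-fromℕ (inject₁ q) (inject₁ ∘ parent T)
                     | toℕ-inject₁ q | toℕ-fromℕ (m T) = ℕ.≤-pred (toℕ<n q)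
  ... | ‵inj₁ {i = y} _ rewrite caseLast-inject₁ (inject₁ q) (inject₁ ∘ parent T) y
                              | toℕ-inject₁ (parent T y) | toℕ-inject₁ y = parent< T y

snoc-adj-inject₁ : ∀ T q {a b} → TreeAdj T a b → TreeAdj (snoc T q) (inject₁ a) (inject₁ b)
snoc-adj-inject₁ T q (inj₁ (i , refl , refl)) =
  inj₁ (inject₁ i , refl , caseLast-inject₁ (inject₁ q) (inject₁ ∘ parent T) i)
snoc-adj-inject₁ T q (inj₂ (i , refl , refl)) =
  inj₂ (inject₁ i , refl , caseLast-inject₁ (inject₁ q) (inject₁ ∘ parent T) i)

snoc-adj-last : ∀ T q → TreeAdj (snoc T q) (fromℕ (suc (m T))) (inject₁ q)
snoc-adj-last T q = inj₁ (fromℕ (m T) , refl , caseLast-fromℕ (inject₁ q) (inject₁ ∘ parent T))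

cons : Tree → Tree
cons T = record { m = suc (m T) ; parent = consParent ; parent< = cons-parent< }
  where
  consParent : Fin (suc (m T)) → Fin (suc (suc (m T)))
  consParent zero    = zero
  consParent (suc i) = suc (parent T i)
  cons-parent< : ∀ i → toℕ (consParent i) ≤ toℕ i
  cons-parent< zero    = z≤n
  cons-parent< (suc i) = s≤s (parent< T i)

cons-adj-suc : ∀ T {a b} → TreeAdj T a b → TreeAdj (cons T) (suc a) (suc b)
cons-adj-suc T (inj₁ (i , refl , refl)) = inj₁ (suc i , refl , refl)
cons-adj-suc T (inj₂ (i , refl , refl)) = inj₂ (suc i , refl , refl)

snoc-cong : ∀ {T T′} (I : TreeIso T T′) q → TreeIso (snoc T q) (snoc T′ (to I q))
snoc-cong {T} {T′} I q = record
  { to      = liftLast (to I)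
  ; from    = liftLast (from I)
  ; to∘from = liftLast-inverse (to I) (from I) (to∘from I)
  ; from∘to = liftLast-inverse (from I) (to I) (from∘to I)
  ; to-edge = edge }
  where
  edge : ∀ i → TreeAdj (snoc T′ (to I q)) (liftLast (to I) (suc i)) (liftLast (to I) (parent (snoc T q) i))
  edge i with view i
  ... | ‵fromℕ = subst₂ (TreeAdj (snoc T′ (to I q)))
          (≡-sym (caseLast-fromℕ (fromℕ _) (inject₁ ∘ to I)))
          (≡-sym (trans (cong (liftLast (to I)) (caseLast-fromℕ (inject₁ q) (inject₁ ∘ parent T)))
                        (caseLast-inject₁ (fromℕ _) (inject₁ ∘ to I) q)))
          (snoc-adj-last T′ (to I q))
  ... | ‵inj₁ {i = y} _ = subst₂ (TreeAdj (snoc T′ (to I q)))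
          (≡-sym (caseLast-inject₁ (fromℕ _) (inject₁ ∘ to I) (suc y)))
          (≡-sym (trans (cong (liftLast (to I)) (caseLast-inject₁ (inject₁ q) (inject₁ ∘ parent T) y))
                        (caseLast-inject₁ (fromℕ _) (inject₁ ∘ to I) (parent T y))))
          (snoc-adj-inject₁ T′ (to I q) (to-edge I y))

-- The new leaf of snoc T q becomes the root; its only child is the root of T′, the image of q.
snoc≅cons : ∀ {T T′} (I : TreeIso T T′) {q} → from I zero ≡ q → TreeIso (snoc T q) (cons T′)
snoc≅cons {T} {T′} I {q} from-root = record
  { to      = toC
  ; from    = fromC
  ; to∘from = λ { zero → caseLast-fromℕ zero (suc ∘ to I)
                ; (suc y) → trans (caseLast-inject₁ zero (suc ∘ to I) (from I y)) (cong suc (to∘from I y)) }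
  ; from∘to = from∘toC
  ; to-edge = edge }
  where
  toC : Node (snoc T q) → Node (cons T′)
  toC = caseLast zero (suc ∘ to I)
  fromC : Node (cons T′) → Node (snoc T q)
  fromC zero    = fromℕ _
  fromC (suc y) = inject₁ (from I y)
  from∘toC : ∀ x → fromC (toC x) ≡ x
  from∘toC x with view x
  ... | ‵fromℕ        = cong fromC (caseLast-fromℕ zero (suc ∘ to I))
  ... | ‵inj₁ {i = y} _ = trans (cong fromC (caseLast-inject₁ zero (suc ∘ to I) y)) (cong inject₁ (from∘to I y))
  open ≡-Reasoning
  edge : ∀ i → TreeAdj (cons T′) (toC (suc i)) (toC (parent (snoc T q) i))
  edge i with view i
  ... | ‵fromℕ = subst₂ (TreeAdj (cons T′))
          (≡-sym (caseLast-fromℕ zero (suc ∘ to I)))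
          (≡-sym (begin
            toC (parent (snoc T q) (fromℕ (m T))) ≡⟨ cong toC (caseLast-fromℕ (inject₁ q) (inject₁ ∘ parent T)) ⟩
            toC (inject₁ q)                       ≡⟨ caseLast-inject₁ zero (suc ∘ to I) q ⟩
            suc (to I q)                          ≡⟨ cong (suc ∘ to I) (≡-sym from-root) ⟩
            suc (to I (from I zero))              ≡⟨ cong suc (to∘from I zero) ⟩
            suc zero                              ∎))
          (inj₂ (zero , refl , refl))
  ... | ‵inj₁ {i = y} _ = subst₂ (TreeAdj (cons T′))
          (≡-sym (caseLast-inject₁ zero (suc ∘ to I) (suc y)))
          (≡-sym (trans (cong toC (caseLast-inject₁ (inject₁ q) (inject₁ ∘ parent T) y))
                        (caseLast-inject₁ zero (suc ∘ to I) (parent T y))))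
          (cons-adj-suc T′ (to-edge I y))

lowerLast : ∀ {k} (x : Fin (suc (suc k))) → toℕ x ≤ k → Fin (suc k)
lowerLast x x≤k = lower₁ x (λ k<x → ℕ.≤⇒≯ x≤k (≤-reflexive k<x))

toℕ-lowerLast : ∀ {k} (x : Fin (suc (suc k))) (x≤k : toℕ x ≤ k) → toℕ (lowerLast x x≤k) ≡ toℕ x
toℕ-lowerLast x x≤k = toℕ-lower₁ x _

inject₁-lowerLast : ∀ {k} (x : Fin (suc (suc k))) (x≤k : toℕ x ≤ k) → inject₁ (lowerLast x x≤k) ≡ x
inject₁-lowerLast x x≤k = inject₁-lower₁ x _

module DropLast k (par : Fin (suc k) → Fin (suc (suc k))) (par< : ∀ i → toℕ (par i) ≤ toℕ i) where

  par⁻-bound : ∀ i → toℕ (par (inject₁ i)) ≤ k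
  par⁻-bound i = ≤-trans (par< (inject₁ i)) (≤-trans (≤-reflexive (toℕ-inject₁ i)) (ℕ.<⇒≤ (toℕ<n i)))

  par⁻ : Fin k → Fin (suc k)
  par⁻ i = lowerLast (par (inject₁ i)) (par⁻-bound i)

  par⁻< : ∀ i → toℕ (par⁻ i) ≤ toℕ i
  par⁻< i = begin
    toℕ (par⁻ i)             ≡⟨ toℕ-lowerLast (par (inject₁ i)) (par⁻-bound i) ⟩
    toℕ (par (inject₁ i))    ≤⟨ par< (inject₁ i) ⟩
    toℕ (inject₁ i)          ≡⟨ toℕ-inject₁ i ⟩
    toℕ i                    ∎
    where open ℕ.≤-Reasoning

  lastParent-bound : toℕ (par (fromℕ k)) ≤ k
  lastParent-bound = ≤-trans (par< (fromℕ k)) (≤-reflexive (toℕ-fromℕ k))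

  lastParent : Fin (suc k)
  lastParent = lowerLast (par (fromℕ k)) lastParent-bound

  T⁻ : Tree
  T⁻ = record { m = k ; parent = par⁻ ; parent< = par⁻< }

  T≅snoc : TreeIso (record { m = suc k ; parent = par ; parent< = par< }) (snoc T⁻ lastParent)
  T≅snoc = record
    { to = λ x → x ; from = λ x → x ; to∘from = λ _ → refl ; from∘to = λ _ → refl
    ; to-edge = λ i → inj₁ (i , refl , same-parent i) }
    where
    same-parent : ∀ i → snocParent T⁻ lastParent i ≡ par i
    same-parent i with view i
    ... | ‵fromℕ = trans (caseLast-fromℕ (inject₁ lastParent) (inject₁ ∘ par⁻))
                         (inject₁-lowerLast (par (fromℕ k)) lastParent-bound)
    ... | ‵inj₁ {i = y} _ = trans (caseLast-inject₁ (inject₁ lastParent) (inject₁ ∘ par⁻) y)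
                                  (inject₁-lowerLast (par (inject₁ y)) (par⁻-bound y))

-- Removing the last node (always a leaf) and rerooting the rest by recursion: if c is
-- that leaf, the rest is rerooted at its parent and c is put on top as the new root.
reroot : ∀ T (c : Node T) → Σ Tree λ T′ → Σ (TreeIso T T′) λ I → from I zero ≡ c
reroot T = go (m T) (parent T) (parent< T)
  where
  go : ∀ k par (par< : ∀ i → toℕ (par i) ≤ toℕ i) (c : Fin (suc k))
     → Σ Tree λ T′ → Σ (TreeIso (record { m = k ; parent = par ; parent< = par< }) T′) λ I → from I zero ≡ c
  go zero    par par< zero = _ , TreeIso-refl _ , refl
  go (suc k) par par< c with view c
  ... | ‵fromℕ = let T′ , I , root = go k par⁻ par⁻< lastParent in
                 cons T′ , snoc≅cons I root ∘ᵗ T≅snoc , refl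
    where open DropLast k par par<
  ... | ‵inj₁ {i = c⁻} _ = let T′ , I , root = go k par⁻ par⁻< c⁻ in
                          snoc T′ (to I lastParent) , snoc-cong I lastParent ∘ᵗ T≅snoc , cong inject₁ root
    where open DropLast k par par<

-- Gluing two decompositions along a common bag

DistLe-mono : ∀ {n} {G : Graph n} {U U′ c w k} → U ⊆ U′ → DistLe G U c w k → DistLe G U′ c w k
DistLe-mono U⊆U′ (l , l≤k , p) = l , l≤k , walk-mono U⊆U′ p

data Split (k l : ℕ) : Fin (k + l) → Set where
  left  : ∀ a → Split k l (a ↑ˡ l)
  right : ∀ b → Split k l (k ↑ʳ b)

split : ∀ k l x → Split k l x
split zero    l x       = right x
split (suc k) l zero    = left zero
split (suc k) l (suc x) with split k l x
... | left a  = left (suc a)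
... | right b = right b

-- The tree of D₂ is hung below node c₁ of the tree of D₁, through its root.
module Glue {n} {G : Graph n} {S U₁ U₂ : Subset n}
  (U₁∩U₂⊆S : ∀ {v} → v ∈ U₁ → v ∈ U₂ → v ∈ S)
  (D₁ : TreeDecomposition G U₁) (c₁ : Node (tree D₁)) (S⊆c₁ : S ⊆ bag D₁ c₁)
  (D₂ : TreeDecomposition G U₂) (S⊆root₂ : S ⊆ bag D₂ zero) where

  private
    T₁ = tree D₁
    T₂ = tree D₂
    m₁ = m T₁
    m₂ = m T₂

  L : Node T₁ → Fin (suc m₁ + suc m₂)
  L a = a ↑ˡ suc m₂

  R : Node T₂ → Fin (suc m₁ + suc m₂)
  R b = suc m₁ ↑ʳ b

  glueParent′ : Fin m₁ ⊎ Fin (suc m₂) → Fin (suc m₁ + suc m₂)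
  glueParent′ (inj₁ i)       = L (parent T₁ i)
  glueParent′ (inj₂ zero)    = L c₁
  glueParent′ (inj₂ (suc j)) = R (parent T₂ j)

  glueParent : Fin (m₁ + suc m₂) → Fin (suc m₁ + suc m₂)
  glueParent = glueParent′ ∘ splitAt m₁

  glueParent< : ∀ i → toℕ (glueParent i) ≤ toℕ i
  glueParent< i with split m₁ (suc m₂) i
  ... | left i₁ rewrite splitAt-↑ˡ m₁ i₁ (suc m₂) | toℕ-↑ˡ (parent T₁ i₁) (suc m₂) | toℕ-↑ˡ i₁ (suc m₂) =
    parent< T₁ i₁
  ... | right zero rewrite splitAt-↑ʳ m₁ (suc m₂) zero | toℕ-↑ˡ c₁ (suc m₂) | toℕ-↑ʳ m₁ (zero {m₂}) =
    ≤-trans (ℕ.≤-pred (toℕ<n c₁)) (ℕ.m≤m+n m₁ 0)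
  ... | right (suc j) rewrite splitAt-↑ʳ m₁ (suc m₂) (suc j) | toℕ-↑ʳ (suc m₁) (parent T₂ j) | toℕ-↑ʳ m₁ (suc j) =
    ≤-trans (ℕ.+-monoʳ-≤ (suc m₁) (parent< T₂ j)) (≤-reflexive (≡-sym (ℕ.+-suc m₁ (toℕ j))))

  glueTree : Tree
  glueTree = record { m = m₁ + suc m₂ ; parent = glueParent ; parent< = glueParent< }

  L-adj : ∀ {a b} → TreeAdj T₁ a b → TreeAdj glueTree (L a) (L b)
  L-adj (inj₁ (i , refl , refl)) = inj₁ (i ↑ˡ suc m₂ , refl , cong glueParent′ (splitAt-↑ˡ m₁ i (suc m₂)))
  L-adj (inj₂ (i , refl , refl)) = inj₂ (i ↑ˡ suc m₂ , refl , cong glueParent′ (splitAt-↑ˡ m₁ i (suc m₂)))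

  R-adj : ∀ {a b} → TreeAdj T₂ a b → TreeAdj glueTree (R a) (R b)
  R-adj (inj₁ (j , refl , refl)) = inj₁ (m₁ ↑ʳ suc j , refl , cong glueParent′ (splitAt-↑ʳ m₁ (suc m₂) (suc j)))
  R-adj (inj₂ (j , refl , refl)) = inj₂ (m₁ ↑ʳ suc j , refl , cong glueParent′ (splitAt-↑ʳ m₁ (suc m₂) (suc j)))

  bridge : TreeAdj glueTree (R zero) (L c₁)
  bridge = inj₁ (m₁ ↑ʳ zero , refl , cong glueParent′ (splitAt-↑ʳ m₁ (suc m₂) zero))

  glueBag : Fin (suc m₁ + suc m₂) → Subset n
  glueBag = [ bag D₁ , bag D₂ ] ∘ splitAt (suc m₁)

  glueBag-L : ∀ a → glueBag (L a) ≡ bag D₁ a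
  glueBag-L a = cong [ bag D₁ , bag D₂ ] (splitAt-↑ˡ (suc m₁) a (suc m₂))

  glueBag-R : ∀ b → glueBag (R b) ≡ bag D₂ b
  glueBag-R b = cong [ bag D₁ , bag D₂ ] (splitAt-↑ʳ (suc m₁) (suc m₂) b)

  module _ {v : Fin n} where

    ∈L⁺ : ∀ {a} → v ∈ bag D₁ a → v ∈ glueBag (L a)
    ∈L⁺ {a} = subst (v ∈_) (≡-sym (glueBag-L a))

    ∈L⁻ : ∀ {a} → v ∈ glueBag (L a) → v ∈ bag D₁ a
    ∈L⁻ {a} = subst (v ∈_) (glueBag-L a)

    ∈R⁺ : ∀ {b} → v ∈ bag D₂ b → v ∈ glueBag (R b)
    ∈R⁺ {b} = subst (v ∈_) (≡-sym (glueBag-R b))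

    ∈R⁻ : ∀ {b} → v ∈ glueBag (R b) → v ∈ bag D₂ b
    ∈R⁻ {b} = subst (v ∈_) (glueBag-R b)

  module _ (v : Fin n) where
    private
      X = nodesWith glueTree glueBag v

    walk₁ : ∀ {a b} → v ∈ bag D₁ a → v ∈ bag D₁ b → ∃[ k ] Walk (TreeAdj glueTree) X (L a) (L b) k
    walk₁ {a} {b} v∈a v∈b =
      let k , p = subtree D₁ v (bag⊆ D₁ a v∈a) a b (∈nodesWith⁺ T₁ (bag D₁) v∈a) (∈nodesWith⁺ T₁ (bag D₁) v∈b)
      in k , walk-map L L-adj (∈nodesWith⁺ glueTree glueBag ∘ ∈L⁺ ∘ ∈nodesWith⁻ T₁ (bag D₁)) p

    walk₂ : ∀ {a b} → v ∈ bag D₂ a → v ∈ bag D₂ b → ∃[ k ] Walk (TreeAdj glueTree) X (R a) (R b) k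
    walk₂ {a} {b} v∈a v∈b =
      let k , p = subtree D₂ v (bag⊆ D₂ a v∈a) a b (∈nodesWith⁺ T₂ (bag D₂) v∈a) (∈nodesWith⁺ T₂ (bag D₂) v∈b)
      in k , walk-map R R-adj (∈nodesWith⁺ glueTree glueBag ∘ ∈R⁺ ∘ ∈nodesWith⁻ T₂ (bag D₂)) p

    glue-subtree : ConnectedOn (TreeAdj glueTree) X
    glue-subtree x y x∋v y∋v
      with split (suc m₁) (suc m₂) x | split (suc m₁) (suc m₂) y
         | ∈nodesWith⁻ glueTree glueBag x∋v | ∈nodesWith⁻ glueTree glueBag y∋v
    ... | left a  | left b  | v∈x | v∈y = walk₁ (∈L⁻ v∈x) (∈L⁻ v∈y)
    ... | right a | right b | v∈x | v∈y = walk₂ (∈R⁻ v∈x) (∈R⁻ v∈y)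
    -- A vertex in bags on both sides lies in S, hence in both ends of the bridge.
    ... | left a  | right b | v∈x | v∈y =
      let v∈S     = U₁∩U₂⊆S (bag⊆ D₁ a (∈L⁻ v∈x)) (bag⊆ D₂ b (∈R⁻ v∈y))
          k₁ , p₁ = walk₁ (∈L⁻ v∈x) (S⊆c₁ v∈S)
          k₂ , p₂ = walk₂ (S⊆root₂ v∈S) (∈R⁻ v∈y)
      in _ , p₁ ++ʷ step (∈nodesWith⁺ glueTree glueBag (∈L⁺ (S⊆c₁ v∈S))) (TreeAdj-sym {glueTree} bridge) p₂
    ... | right a | left b  | v∈x | v∈y =
      let v∈S     = U₁∩U₂⊆S (bag⊆ D₁ b (∈L⁻ v∈y)) (bag⊆ D₂ a (∈R⁻ v∈x))
          k₂ , p₂ = walk₂ (∈R⁻ v∈x) (S⊆root₂ v∈S)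
          k₁ , p₁ = walk₁ (S⊆c₁ v∈S) (∈L⁻ v∈y)
      in _ , p₂ ++ʷ step (∈nodesWith⁺ glueTree glueBag (∈R⁺ (S⊆root₂ v∈S))) bridge p₁

  module _ (covered : ∀ v → v ∈ U₁ ⊎ v ∈ U₂)
           (edge-inside : ∀ {u v} → Edge G u v → (u ∈ U₁ × v ∈ U₁) ⊎ (u ∈ U₂ × v ∈ U₂)) where

    glue : TreeDecomposition G ⊤
    glue = record
      { tree    = glueTree
      ; bag     = glueBag
      ; bag⊆    = λ _ _ → ∈⊤
      ; covers  = λ v _ → [ (λ v∈U₁ → let t , v∈t = covers D₁ v v∈U₁ in L t , ∈L⁺ v∈t)
                          , (λ v∈U₂ → let t , v∈t = covers D₂ v v∈U₂ in R t , ∈R⁺ v∈t) ] (covered v)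
      ; edges   = λ u v _ _ u~v →
          [ (λ (u∈U₁ , v∈U₁) → let t , u∈t , v∈t = edges D₁ u v u∈U₁ v∈U₁ u~v in L t , ∈L⁺ u∈t , ∈L⁺ v∈t)
          , (λ (u∈U₂ , v∈U₂) → let t , u∈t , v∈t = edges D₂ u v u∈U₂ v∈U₂ u~v in R t , ∈R⁺ u∈t , ∈R⁺ v∈t)
          ] (edge-inside u~v)
      ; subtree = λ v _ → glue-subtree v
      }

    glue-breadth : ∀ {k} → BreadthLe D₁ k → BreadthLe D₂ k → BreadthLe glue k
    glue-breadth b₁ b₂ t with split (suc m₁) (suc m₂) t
    ... | left a  = let c , _ , near = b₁ a in
                    c , ∈⊤ , λ w w∈t → DistLe-mono {G = G} (λ _ → ∈⊤) (near w (∈L⁻ w∈t))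
    ... | right b = let c , _ , near = b₂ b in
                    c , ∈⊤ , λ w w∈t → DistLe-mono {G = G} (λ _ → ∈⊤) (near w (∈R⁻ w∈t))

-- Restriction, and the two sides of a clique separator

Edge-sym : ∀ {n} (G : Graph n) {u v} → Edge G u v → Edge G v u
Edge-sym G {u} {v} = trans (sym G v u)

module _ {n} {G : Graph n} where

  -- A decomposition of breadth 0 has single-vertex bags, so no bag holds both ends of an edge.
  edge⇒¬breadth0 : ∀ {U u v} → u ∈ U → v ∈ U → Edge G u v → (D : TreeDecomposition G U) → ¬ BreadthLe D 0
  edge⇒¬breadth0 {u = u} u∈U v∈U u~v D b with edges D u _ u∈U v∈U u~v
  ... | t , u∈t , v∈t with b t
  ...   | c , _ , near with near u u∈t | near _ v∈t
  ...     | zero , z≤n , here _ | zero , z≤n , here _ with trans (≡-sym u~v) (irrefl G u)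
  ...       | ()

  restrict : ∀ {W} → TreeDecomposition G W → (U : Subset n) → U ⊆ W → TreeDecomposition G U
  restrict D U U⊆W = record
    { tree    = tree D
    ; bag     = λ t → bag D t ∩ U
    ; bag⊆    = λ t → proj₂ ∘ x∈p∩q⁻ _ _
    ; covers  = λ v v∈U → let t , v∈t = covers D v (U⊆W v∈U) in t , x∈p∩q⁺ (v∈t , v∈U)
    ; edges   = λ u v u∈U v∈U u~v → let t , u∈t , v∈t = edges D u v (U⊆W u∈U) (U⊆W v∈U) u~v in
                  t , x∈p∩q⁺ (u∈t , u∈U) , x∈p∩q⁺ (v∈t , v∈U)
    ; subtree = λ v v∈U a b a∋v b∋v →
        let k , p = subtree D v (U⊆W v∈U) a b (shrink a∋v) (shrink b∋v)
        in k , walk-mono (λ {x} x∋v → ∈nodesWith⁺ (tree D) bag′ (x∈p∩q⁺ (∈nodesWith⁻ (tree D) (bag D) x∋v , v∈U))) p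
    }
    where
    bag′ = λ t → bag D t ∩ U
    shrink : ∀ {v t} → t ∈ nodesWith (tree D) bag′ v → t ∈ nodesWith (tree D) (bag D) v
    shrink = ∈nodesWith⁺ (tree D) (bag D) ∘ proj₁ ∘ x∈p∩q⁻ _ _ ∘ ∈nodesWith⁻ (tree D) bag′

  short-walk-within : ∀ {W U c w l} → Walk (Edge G) W c w l → l ≤ 1 → c ∈ U → w ∈ U → Walk (Edge G) U c w l
  short-walk-within (here _)                  _             c∈U w∈U = here c∈U
  short-walk-within (step _ c~w (here _))     _             c∈U w∈U = step c∈U c~w (here w∈U)
  short-walk-within (step _ _ (step _ _ _))   (s≤s ())      _   _

  -- A bag whose centre lies outside U meets U only inside S, a clique: any of its vertices can serve as centre.
  restrict-breadth≤1 : ∀ {W S U} (D : TreeDecomposition G W) (U⊆W : U ⊆ W) → Clique G S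
    → (∀ c w → c ∉ U → w ∈ U → Edge G c w → w ∈ S) → Nonempty U
    → BreadthLe D 1 → BreadthLe (restrict D U U⊆W) 1
  restrict-breadth≤1 {S = S} {U} D U⊆W clique boundary (u , u∈U) b t with b t
  ... | c , _ , near with c ∈? U
  ...   | yes c∈U = c , c∈U , λ w w∈t∩U →
            let l , l≤1 , p = near w (proj₁ (x∈p∩q⁻ _ _ w∈t∩U))
            in l , l≤1 , short-walk-within p l≤1 c∈U (proj₂ (x∈p∩q⁻ _ _ w∈t∩U))
  ...   | no c∉U with nonempty? (bag D t ∩ U)
  ...     | no empty = u , u∈U , λ w w∈t∩U → ⊥-elim (empty (w , w∈t∩U))
  ...     | yes (c′ , c′∈t∩U) = c′ , proj₂ (x∈p∩q⁻ _ _ c′∈t∩U) , λ w w∈t∩U → adjacent w w∈t∩U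
    where
    ∈S : ∀ w → w ∈ bag D t ∩ U → w ∈ S
    ∈S w w∈t∩U with near w (proj₁ (x∈p∩q⁻ _ _ w∈t∩U))
    ... | zero , _ , here _                = ⊥-elim (c∉U (proj₂ (x∈p∩q⁻ _ _ w∈t∩U)))
    ... | suc zero , _ , step _ c~w (here _) = boundary c w c∉U (proj₂ (x∈p∩q⁻ _ _ w∈t∩U)) c~w
    ... | suc (suc _) , s≤s () , _
    adjacent : ∀ w → w ∈ bag D t ∩ U → DistLe G U c′ w 1
    adjacent w w∈t∩U with c′ Fin.≟ w
    ... | yes refl = 0 , z≤n , here (proj₂ (x∈p∩q⁻ _ _ w∈t∩U))
    ... | no c′≢w  = 1 , ≤-refl , step (proj₂ (x∈p∩q⁻ _ _ c′∈t∩U))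
                       (clique c′ w (∈S c′ c′∈t∩U) (∈S w w∈t∩U) c′≢w) (here (proj₂ (x∈p∩q⁻ _ _ w∈t∩U)))

  walk-stays-in : ∀ {S C W} → (∀ u w → u ∈ C → w ∉ S → Edge G u w → w ∈ C) → (∀ z → z ∈ W → z ∉ S)
    → ∀ {u v k} → Walk (Edge G) W u v k → u ∈ C → v ∈ C
  walk-stays-in C-closed W∩S=∅ (here _)          u∈C = u∈C
  walk-stays-in C-closed W∩S=∅ (step _ u~w p) u∈C =
    walk-stays-in C-closed W∩S=∅ p (C-closed _ _ u∈C (W∩S=∅ _ (walk-source∈ p)) u~w)

  component-≡ : ∀ {S C C′ x} → Component G S C → Component G S C′ → x ∈ C → x ∈ C′ → C ≡ C′
  component-≡ {x = x} (C∩S=∅ , _ , C-conn , C-closed) (C′∩S=∅ , _ , C′-conn , C′-closed) x∈C x∈C′ =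
    ⊆-antisym (λ y∈C  → walk-stays-in C′-closed C∩S=∅  (proj₂ (C-conn x _ x∈C y∈C)) x∈C′)
              (λ y∈C′ → walk-stays-in C-closed  C′∩S=∅ (proj₂ (C′-conn x _ x∈C′ y∈C′)) x∈C)

  full-component-neighbour : ∀ {S C s} → FullComponent G S C → s ∈ S → ∃ λ c → c ∈ C × Edge G c s
  full-component-neighbour (_ , N[C]=S) s∈S = proj₂ (proj₂ (N[C]=S _) s∈S)

  minimal-separator-nonempty : ∀ {S} → Connected G → MinimalSeparator G S → Nonempty S
  minimal-separator-nonempty {S} conn
    (_ , _ , (comp₁@(_ , (x₁ , x₁∈C₁) , _ , C₁-closed) , _) , (comp₂@(_ , (x₂ , x₂∈C₂) , _) , _) , C₁≢C₂)
    with nonempty? S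
  ... | yes ne    = ne
  ... | no  empty = ⊥-elim (C₁≢C₂ (component-≡ comp₁ comp₂ x₂∈C₁ x₂∈C₂))
    where
    x₂∈C₁ = walk-stays-in C₁-closed (λ z _ z∈S → empty (z , z∈S)) (proj₂ (conn x₁ x₂ ∈⊤ ∈⊤)) x₁∈C₁

  other-full-component : ∀ {S} (A : Subset n) → MinimalSeparator G S → ∃ λ C → FullComponent G S C × C ≢ A
  other-full-component A (C₁ , C₂ , full₁ , full₂ , C₁≢C₂) with ≡-dec _≟ᵇ_ C₁ A
  ... | yes refl = C₂ , full₂ , C₁≢C₂ ∘ ≡-sym
  ... | no C₁≢A  = C₁ , full₁ , C₁≢A

  neighbour-outside : ∀ {S A s} → MinimalSeparator G S → Component G S A → s ∈ S → ∃ λ b → b ∉ A × Edge G b s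
  neighbour-outside {A = A} minSep A-comp s∈S =
    let C , full , C≢A = other-full-component A minSep
        b , b∈C , b~s  = full-component-neighbour full s∈S
    in b , (λ b∈A → C≢A (component-≡ (proj₁ full) A-comp b∈C b∈A)) , b~s

module CliqueSeparator {n} {G : Graph n} {S A : Subset n} (clique : Clique G S) (A-comp : Component G S A) where

  private
    A∩S=∅ = proj₁ A-comp
    A-closed = proj₂ (proj₂ (proj₂ A-comp))

  S⊆A∪S : S ⊆ A ∪ S
  S⊆A∪S s∈S = x∈p∪q⁺ (inj₂ s∈S)

  S⊆∁A : S ⊆ ∁ A
  S⊆∁A s∈S = x∉p⇒x∈∁p (λ s∈A → A∩S=∅ _ s∈A s∈S)

  neighbour∈A∪S : ∀ {u v} → u ∈ A → Edge G u v → v ∈ A ∪ S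
  neighbour∈A∪S {u} {v} u∈A u~v with v ∈? S
  ... | yes v∈S = x∈p∪q⁺ (inj₂ v∈S)
  ... | no  v∉S = x∈p∪q⁺ (inj₁ (A-closed u v u∈A v∉S u~v))

  A∪S∩∁A⊆S : ∀ {v} → v ∈ A ∪ S → v ∈ ∁ A → v ∈ S
  A∪S∩∁A⊆S v∈A∪S v∈∁A with x∈p∪q⁻ A S v∈A∪S
  ... | inj₁ v∈A = ⊥-elim (x∈∁p⇒x∉p v∈∁A v∈A)
  ... | inj₂ v∈S = v∈S

  A∪S-boundary : ∀ c w → c ∉ A ∪ S → w ∈ A ∪ S → Edge G c w → w ∈ S
  A∪S-boundary c w c∉A∪S w∈A∪S c~w with x∈p∪q⁻ A S w∈A∪S
  ... | inj₁ w∈A = ⊥-elim (c∉A∪S (neighbour∈A∪S w∈A (Edge-sym G c~w)))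
  ... | inj₂ w∈S = w∈S

  ∁A-boundary : ∀ c w → c ∉ ∁ A → w ∈ ∁ A → Edge G c w → w ∈ S
  ∁A-boundary c w c∉∁A w∈∁A c~w =
    A∪S∩∁A⊆S (neighbour∈A∪S (x∉∁p⇒x∈p c∉∁A) c~w) w∈∁A

  covered : ∀ v → v ∈ A ∪ S ⊎ v ∈ ∁ A
  covered v with v ∈? A
  ... | yes v∈A = inj₁ (x∈p∪q⁺ (inj₁ v∈A))
  ... | no  v∉A = inj₂ (x∉p⇒x∈∁p v∉A)

  edge-inside : ∀ {u v} → Edge G u v → (u ∈ A ∪ S × v ∈ A ∪ S) ⊎ (u ∈ ∁ A × v ∈ ∁ A)
  edge-inside {u} {v} u~v with u ∈? A | v ∈? A
  ... | yes u∈A | _       = inj₁ (x∈p∪q⁺ (inj₁ u∈A) , neighbour∈A∪S u∈A u~v)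
  ... | no  _   | yes v∈A = inj₁ (neighbour∈A∪S v∈A (Edge-sym G u~v) , x∈p∪q⁺ (inj₁ v∈A))
  ... | no  u∉A | no  v∉A = inj₂ (x∉p⇒x∈∁p u∉A , x∉p⇒x∈∁p v∉A)

  split-breadth≤1 : Nonempty S → (D : TreeDecomposition G ⊤) → BreadthLe D 1
    → (∃[ D₁ ] BreadthLe {G = G} {A ∪ S} D₁ 1) × (∃[ D₂ ] BreadthLe {G = G} {∁ A} D₂ 1)
  split-breadth≤1 (s , s∈S) D b =
      (restrict D (A ∪ S) (λ _ → ∈⊤) , restrict-breadth≤1 D (λ _ → ∈⊤) clique A∪S-boundary (s , S⊆A∪S s∈S) b)
    , (restrict D (∁ A) (λ _ → ∈⊤) , restrict-breadth≤1 D (λ _ → ∈⊤) clique ∁A-boundary (s , S⊆∁A s∈S) b)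

  glue-breadth≤1 : ∃[ D₁ ] BreadthLe {G = G} {A ∪ S} D₁ 1 → ∃[ D₂ ] BreadthLe {G = G} {∁ A} D₂ 1
    → ∃[ D ] BreadthLe {G = G} {⊤} D 1
  glue-breadth≤1 (D₁ , b₁) (D₂ , b₂) =
    let c₁ , S⊆c₁     = clique⊆bag D₁ clique S⊆A∪S
        c₂ , S⊆c₂     = clique⊆bag D₂ clique S⊆∁A
        _ , I , root = reroot (tree D₂) c₂
        S⊆root : S ⊆ bag (transfer D₂ I) zero
        S⊆root = λ {v} v∈S → subst (λ t → v ∈ bag D₂ t) (≡-sym root) (S⊆c₂ v∈S)
        open Glue A∪S∩∁A⊆S D₁ c₁ S⊆c₁ (transfer D₂ I) S⊆root
    in glue covered edge-inside , glue-breadth covered edge-inside b₁ (transfer-breadth D₂ I b₂)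

lemma10 : ∀ {n : ℕ} (G : Graph n) (S A : Subset n)
          → Connected G
          → MinimalSeparator G S
          → Clique G S
          → FullComponent G S A
          → TbOne G ⊤ ⇔ (TbOne G (A ∪ S) × TbOne G (∁ A))
lemma10 G S A connected minSep clique full@(A-comp , _)
  with minimal-separator-nonempty {G = G} connected minSep
... | s , s∈S
  with full-component-neighbour {G = G} full s∈S | neighbour-outside {G = G} minSep A-comp s∈S
... | a , a∈A , a~s | b , b∉A , b~s = mk⇔
  (λ ((D , D-breadth) , _) → let D₁ , D₂ = split-breadth≤1 (s , s∈S) D D-breadth in
      (D₁ , edge⇒¬breadth0 (x∈p∪q⁺ (inj₁ a∈A)) (S⊆A∪S s∈S) a~s)
    , (D₂ , edge⇒¬breadth0 (x∉p⇒x∈∁p b∉A) (S⊆∁A s∈S) b~s))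
  (λ ((D₁ , _) , (D₂ , _)) → glue-breadth≤1 D₁ D₂ , edge⇒¬breadth0 ∈⊤ ∈⊤ a~s)
  where open CliqueSeparator clique A-comp
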